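{- Let $S$ be a numerical semigroup with minimal set of generators $m=a_1<a_2<\cdots<a_n$ (with $n\geq 2$), and put $$d(S)=\frac{2a_n\left\lfloor \frac{m}{n}\right\rfloor-m+1}{a_2-m}.$$ For each $1\leq i<m$, let $c_i$ be any element of $S$ with $c_i \geq d(S)\sum_{j=2}^n a_j$ and $c_i\equiv i \pmod m$, let $$K_i=\max\Big\{\sum_{j=1}^n k_{ij} \;:\; k_{ij}\in\mathbb{Z}_{\geq 0},\ \sum_{j=1}^n k_{ij}a_j=c_i\Big\},$$ and let $g_i=c_i-(K_i-1)m$. Set $g_0=m$. Then $\operatorname{MED}(S)=\langle g_0,g_1,\dots,g_{m-1}\rangle$.
   Context: A numerical semigroup is an additive submonoid $S \subseteq \mathbb{Z}_{\geq 0}$ with $\mathbb{Z}_{\geq 0}\setminus S$ finite; it has a unique minimal generating set. $m(S)$ is the smallest nonzero element of $S$. $S$ is MED (maximal embedding dimension) if the size of its minimal generating set equals $m(S)$. $\operatorname{MED}(S)$ denotes the smallest (for inclusion) MED numerical semigroup $T\supseteq S$ with $m(T)=m(S)$ (it exists). $\langle A\rangle$ is the submonoid of $\mathbb{Z}_{\geq 0}$ generated by $A$; $\lfloor x\rfloor$ is the integer part. -}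

module Defs where

open import Data.Nat using (ℕ; zero; suc; _+_; _*_; _∸_; _≤_; _<_)
open import Data.Fin using (Fin; toℕ) renaming (zero to fzero; suc to fsuc)
import Data.Fin as F
open import Data.Product using (Σ; ∃; _×_)
open import Relation.Binary.PropositionalEquality using (_≡_; _≢_)
open import Relation.Nullary using (¬_)

∑ : (n : ℕ) → (Fin n → ℕ) → ℕ
∑ zero    f = 0
∑ (suc n) f = f fzero + ∑ n (λ i → f (fsuc i))

Pred : Set₁
Pred = ℕ → Set

_⊆_ : Pred → Pred → Set
S ⊆ T = ∀ x → S x → T x

InMonoid : (k : ℕ) → (Fin k → ℕ) → Pred
InMonoid k b x = Σ (Fin k → ℕ) λ c → ∑ k (λ i → c i * b i) ≡ x

record IsNumSemigroup (S : Pred) : Set where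
  field
    has0      : S 0
    closed    : ∀ x y → S x → S y → S (x + y)
    cofinite  : ∃ λ F → ∀ x → F < x → S x

IsMultiplicity : Pred → ℕ → Set
IsMultiplicity S m = (0 < m) × S m × (∀ x → S x → 0 < x → m ≤ x)

-- b 0 , ... , b (k-1) is the minimal generating set of S:
-- it generates S, and no b i lies in the monoid generated by the others
-- (so no proper subset generates S; this also forces the b i to be distinct
-- and nonzero)
IsMinimalGenerators : Pred → (k : ℕ) → (Fin k → ℕ) → Set
IsMinimalGenerators S k b =
  (∀ x → S x → InMonoid k b x) × (∀ x → InMonoid k b x → S x) ×
  (∀ i → ¬ (Σ (Fin k → ℕ) λ c → (c i ≡ 0) × (∑ k (λ j → c j * b j) ≡ b i)))

IsMED : Pred → Set
IsMED T = Σ ℕ λ e → IsMultiplicity T e × Σ (Fin e → ℕ) λ b → IsMinimalGenerators T e b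

IsMEDClosure : Pred → ℕ → Pred → Set₁
IsMEDClosure S m T =
  IsNumSemigroup T × S ⊆ T × IsMultiplicity T m × IsMED T ×
  (∀ (T' : Pred) → IsNumSemigroup T' → S ⊆ T' → IsMultiplicity T' m → IsMED T' → T ⊆ T')

StrictlyIncreasing : (n : ℕ) → (Fin n → ℕ) → Set
StrictlyIncreasing n a = ∀ (i j : Fin n) → i F.< j → a i < a j

IsMaxLength : (n : ℕ) → (Fin n → ℕ) → ℕ → ℕ → Set
IsMaxLength n a c K =
  (Σ (Fin n → ℕ) λ k → (∑ n (λ j → k j * a j) ≡ c) × (∑ n k ≡ K)) ×
  (∀ (k : Fin n → ℕ) → ∑ n (λ j → k j * a j) ≡ c → ∑ n k ≤ K)

gSeq : ℕ → (ℕ → ℕ) → (ℕ → ℕ) → ℕ → ℕ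
gSeq m c K zero    = m
gSeq m c K (suc i) = c (suc i) ∸ (K (suc i) ∸ 1) * m

{-# OPTIONS --safe #-}
-- MED(S) is {0} ∪ (m + ⟨m, a₂ ∸ m, …, aₙ ∸ m⟩).  Every MED semigroup T′ of multiplicity m has
-- x + y ∸ m ∈ T′ for nonzero x, y ∈ T′ (its m minimal generators meet every residue class mod m),
-- so T′ ⊇ S contains this shifted monoid.  Conversely the shifted monoid with 0 is MED, generated
-- by m and the least element of each nonzero class mod m, and gᵢ is that least element:
-- gᵢ = m + Σⱼ eⱼ (aⱼ ∸ m) for a factorization e of cᵢ of maximal length Kᵢ, while any
-- y = m + t m + Σ_{l ∈ L} (aₗ ∸ m) in the class of i can be rewritten with |L| < m by deleting
-- blocks of L of weight divisible by m.  Then Σ_L aₗ ≤ (m ∸ 1) aₙ ≤ cᵢ (this is where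
-- cᵢ ≥ d(S) Σⱼ aⱼ is used), so cᵢ = Σ_L aₗ + p m has a factorization of length |L| + p ≤ Kᵢ,
-- and that gives gᵢ ≤ y.
module Submission where

open import Defs
open import Data.Nat using (ℕ; zero; suc; _+_; _*_; _∸_; _≤_; _≥_; _<_; _/_; _%_; NonZero; z≤n; s≤s; s≤s⁻¹; _≟_; _≤?_; >-nonZero; >-nonZero⁻¹; ≢-nonZero)
open import Data.Nat.Properties
open import Data.Nat.DivMod
open import Data.Nat.Induction using (<-wellFounded)
open import Data.Nat.ListAction using (sum)
open import Data.Nat.ListAction.Properties using (sum-++)
open import Data.Nat.Tactic.RingSolver using (solve-∀)
open import Induction.WellFounded using (Acc; acc)
open import Data.Fin using (Fin; toℕ; fromℕ; fromℕ<; punchOut) renaming (zero to fzero; suc to fsuc)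
import Data.Fin.Properties as FP
open import Data.List using (List; []; _∷_; _++_; length; map; take; drop)
open import Data.List.Properties using (map-++; take++drop≡id; take-take; length-++; length-take; length-drop; take-map; drop-map)
open import Data.Product using (Σ; ∃; _×_; _,_; proj₁; proj₂)
open import Data.Sum using (_⊎_; inj₁; inj₂)
open import Data.Empty using (⊥-elim)
open import Function using (_∘_)
open import Relation.Nullary using (¬_; yes; no)
open import Relation.Binary.PropositionalEquality

-- Sums over Fin n and dot products

∑-cong : ∀ n {f g : Fin n → ℕ} → (∀ j → f j ≡ g j) → ∑ n f ≡ ∑ n g
∑-cong zero    f≗g = refl
∑-cong (suc n) f≗g = cong₂ _+_ (f≗g fzero) (∑-cong n (f≗g ∘ fsuc))

∑-zero : ∀ n → ∑ n (λ _ → 0) ≡ 0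
∑-zero zero    = refl
∑-zero (suc n) = ∑-zero n

∑-distrib-+ : ∀ n (f g : Fin n → ℕ) → ∑ n (λ j → f j + g j) ≡ ∑ n f + ∑ n g
∑-distrib-+ zero    f g = refl
∑-distrib-+ (suc n) f g = begin
  f fzero + g fzero + ∑ n (λ j → f (fsuc j) + g (fsuc j))
    ≡⟨ cong (f fzero + g fzero +_) (∑-distrib-+ n (f ∘ fsuc) (g ∘ fsuc)) ⟩
  f fzero + g fzero + (∑ n (f ∘ fsuc) + ∑ n (g ∘ fsuc))
    ≡⟨ +-+-comm (f fzero) (g fzero) _ _ ⟩
  f fzero + ∑ n (f ∘ fsuc) + (g fzero + ∑ n (g ∘ fsuc)) ∎
  where
  open ≡-Reasoning
  +-+-comm : ∀ a b c d → a + b + (c + d) ≡ a + c + (b + d)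
  +-+-comm = solve-∀

∑-distribʳ-* : ∀ n (f : Fin n → ℕ) c → ∑ n (λ j → f j * c) ≡ ∑ n f * c
∑-distribʳ-* zero    f c = refl
∑-distribʳ-* (suc n) f c =
  trans (cong (f fzero * c +_) (∑-distribʳ-* n (f ∘ fsuc) c)) (sym (*-distribʳ-+ c (f fzero) _))

∑-term : ∀ n (f : Fin n → ℕ) i → f i ≤ ∑ n f
∑-term (suc n) f fzero    = m≤m+n _ _
∑-term (suc n) f (fsuc i) = ≤-trans (∑-term n (f ∘ fsuc) i) (m≤n+m _ _)

∑-positive : ∀ n (f : Fin n → ℕ) → 0 < ∑ n f → ∃ λ j → 0 < f j
∑-positive (suc n) f ∑>0 with f fzero ≟ 0
... | no  f0≢0 = fzero , n≢0⇒n>0 f0≢0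
... | yes f0≡0 with ∑-positive n (f ∘ fsuc) (subst (λ x → 0 < x + ∑ n (f ∘ fsuc)) f0≡0 ∑>0)
...   | j , fj>0 = fsuc j , fj>0

∑-≤-const : ∀ n (f : Fin n → ℕ) c → (∀ j → f j ≤ c) → ∑ n f ≤ n * c
∑-≤-const zero    f c f≤c = z≤n
∑-≤-const (suc n) f c f≤c = +-mono-≤ (f≤c fzero) (∑-≤-const n (f ∘ fsuc) c (f≤c ∘ fsuc))

∑-≥-const : ∀ n (f : Fin n → ℕ) c → (∀ j → c ≤ f j) → n * c ≤ ∑ n f
∑-≥-const zero    f c c≤f = z≤n
∑-≥-const (suc n) f c c≤f = +-mono-≤ (c≤f fzero) (∑-≥-const n (f ∘ fsuc) c (c≤f ∘ fsuc))

infix 7 _·_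

_·_ : ∀ {n} → (Fin n → ℕ) → (Fin n → ℕ) → ℕ
_·_ {n} e b = ∑ n (λ j → e j * b j)

·-distribʳ-+ : ∀ {n} (u v b : Fin n → ℕ) → (λ j → u j + v j) · b ≡ u · b + v · b
·-distribʳ-+ {n} u v b =
  trans (∑-cong n (λ j → *-distribʳ-+ (b j) (u j) (v j))) (∑-distrib-+ n _ _)

·-distribˡ-+ : ∀ {n} (e u v : Fin n → ℕ) → e · (λ j → u j + v j) ≡ e · u + e · v
·-distribˡ-+ {n} e u v =
  trans (∑-cong n (λ j → *-distribˡ-+ (e j) (u j) (v j))) (∑-distrib-+ n _ _)

∑≡0⇒·≡0 : ∀ n (e b : Fin n → ℕ) → ∑ n e ≡ 0 → e · b ≡ 0
∑≡0⇒·≡0 zero    e b _    = refl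
∑≡0⇒·≡0 (suc n) e b ∑≡0 = cong₂ _+_
  (cong (_* b fzero) (m+n≡0⇒m≡0 (e fzero) ∑≡0))
  (∑≡0⇒·≡0 n (e ∘ fsuc) (b ∘ fsuc) (m+n≡0⇒n≡0 (e fzero) ∑≡0))

unused-generator : ∀ {n} (e b : Fin n → ℕ) l → e · b < b l → e l ≡ 0
unused-generator {n} e b l e·b<bl with e l ≟ 0
... | yes el≡0 = el≡0
... | no  el≢0 = ⊥-elim (<⇒≱ e·b<bl (≤-trans (m≤m*n (b l) (e l)) ∑-bound))
  where
  instance _ = ≢-nonZero el≢0
  ∑-bound : b l * e l ≤ e · b
  ∑-bound = subst (_≤ e · b) (*-comm (e l) (b l)) (∑-term n (λ j → e j * b j) l)

δ : ∀ {n} → Fin n → Fin n → ℕ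
δ fzero    fzero    = 1
δ fzero    (fsuc _) = 0
δ (fsuc _) fzero    = 0
δ (fsuc i) (fsuc j) = δ i j

δ-≢ : ∀ {n} {i j : Fin n} → i ≢ j → δ i j ≡ 0
δ-≢ {i = fzero}  {fzero}  i≢j = ⊥-elim (i≢j refl)
δ-≢ {i = fzero}  {fsuc _} _   = refl
δ-≢ {i = fsuc _} {fzero}  _   = refl
δ-≢ {i = fsuc _} {fsuc _} i≢j = δ-≢ (i≢j ∘ cong fsuc)

δ-≤ : ∀ {n} (e : Fin n → ℕ) p j → 0 < e p → δ p j ≤ e j
δ-≤ e fzero    fzero    ep>0 = ep>0
δ-≤ e fzero    (fsuc j) _    = z≤n
δ-≤ e (fsuc p) fzero    _    = z≤n
δ-≤ e (fsuc p) (fsuc j) ep>0 = δ-≤ (e ∘ fsuc) p j ep>0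

δ·b : ∀ {n} i (b : Fin n → ℕ) → δ i · b ≡ b i
δ·b {suc n} fzero    b = trans (cong₂ _+_ (+-identityʳ (b fzero)) (∑-zero n)) (+-identityʳ _)
δ·b {suc n} (fsuc i) b = δ·b i (b ∘ fsuc)

extract-generator : ∀ {n} (e b : Fin n → ℕ) → 0 < e · b →
  ∃ λ p → 0 < e p × e · b ≡ (λ j → e j ∸ δ p j) · b + b p
extract-generator {n} e b e·b>0 with ∑-positive n (λ j → e j * b j) e·b>0
... | p , epbp>0 = p , ep>0 , (begin
  e · b                                          ≡⟨ ∑-cong n (λ j → cong (_* b j) (sym (m∸n+n≡m (δ-≤ e p j ep>0)))) ⟩
  (λ j → (e j ∸ δ p j) + δ p j) · b              ≡⟨ ·-distribʳ-+ (λ j → e j ∸ δ p j) (δ p) b ⟩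
  (λ j → e j ∸ δ p j) · b + δ p · b              ≡⟨ cong ((λ j → e j ∸ δ p j) · b +_) (δ·b p b) ⟩
  (λ j → e j ∸ δ p j) · b + b p                  ∎)
  where
  open ≡-Reasoning
  ep>0 : 0 < e p
  ep>0 = n≢0⇒n>0 (λ ep≡0 → n>0⇒n≢0 epbp>0 (cong (_* b p) ep≡0))

%-≡⇒≡+* : ∀ {x y} m .{{_ : NonZero m}} → x % m ≡ y % m → x ≤ y → ∃ λ s → y ≡ x + s * m
%-≡⇒≡+* {x} {y} m x%m≡y%m x≤y = s , (begin
  y                       ≡⟨ m≡m%n+[m/n]*n y m ⟩
  y % m + y / m * m       ≡⟨ cong₂ (λ r q → r + q * m) (sym x%m≡y%m) (sym (m+[n∸m]≡n (/-monoˡ-≤ m x≤y))) ⟩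
  x % m + (x / m + s) * m ≡⟨ regroup (x % m) (x / m) s m ⟩
  x % m + x / m * m + s * m ≡⟨ cong (_+ s * m) (sym (m≡m%n+[m/n]*n x m)) ⟩
  x + s * m               ∎)
  where
  open ≡-Reasoning
  s = y / m ∸ x / m
  regroup : ∀ r q s m → r + (q + s) * m ≡ r + q * m + s * m
  regroup = solve-∀

toℕ-mod : ∀ x m .{{_ : NonZero m}} → toℕ (x mod m) ≡ x % m
toℕ-mod x m = FP.toℕ-fromℕ< (m%n<n x m)

mod-≡⇒%-≡ : ∀ {x y} m .{{_ : NonZero m}} → x mod m ≡ y mod m → x % m ≡ y % m
mod-≡⇒%-≡ {x} {y} m eq = trans (sym (toℕ-mod x m)) (trans (cong toℕ eq) (toℕ-mod y m))

injective⇒surjective : ∀ {n} (f : Fin n → Fin n) → (∀ {i j} → f i ≡ f j → i ≡ j) → ∀ r → ∃ λ j → f j ≡ r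
injective⇒surjective {suc n} f f-inj r with FP.any? (λ j → f j FP.≟ r)
... | yes hit = hit
... | no  miss = ⊥-elim (1+n≰n (FP.injective⇒≤ {f = g} g-inj))
  where
  r≢f : ∀ j → r ≢ f j
  r≢f j r≡fj = miss (j , sym r≡fj)
  g : Fin (suc n) → Fin n
  g j = punchOut (r≢f j)
  g-inj : ∀ {i j} → g i ≡ g j → i ≡ j
  g-inj gi≡gj = f-inj (FP.punchOut-injective (r≢f _) (r≢f _) gi≡gj)

-- Generators, irreducible elements and MED semigroups

Closed+ : Pred → Set
Closed+ T = ∀ x y → T x → T y → T (x + y)

multiples-closed : ∀ {T : Pred} → T 0 → Closed+ T → ∀ {x} → T x → ∀ s → T (s * x)
multiples-closed T0 T+ Tx zero    = T0
multiples-closed T0 T+ Tx (suc s) = T+ _ _ Tx (multiples-closed T0 T+ Tx s)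

module _ {n : ℕ} {b : Fin n → ℕ} where

  InMonoid-0 : InMonoid n b 0
  InMonoid-0 = (λ _ → 0) , ∑-zero n

  InMonoid-+ : Closed+ (InMonoid n b)
  InMonoid-+ x y (u , u·b≡x) (v , v·b≡y) =
    (λ j → u j + v j) , trans (·-distribʳ-+ u v b) (cong₂ _+_ u·b≡x v·b≡y)

  InMonoid-gen : ∀ i → InMonoid n b (b i)
  InMonoid-gen i = δ i , δ·b i b

  InMonoid-* : ∀ {x} → InMonoid n b x → ∀ s → InMonoid n b (s * x)
  InMonoid-* = multiples-closed InMonoid-0 InMonoid-+

  InMonoid-⊆ : ∀ (T : Pred) → T 0 → Closed+ T → (∀ j → T (b j)) → InMonoid n b ⊆ T
  InMonoid-⊆ T T0 T+ Tb x (e , refl) = go n b e Tb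
    where
    go : ∀ n (b e : Fin n → ℕ) → (∀ j → T (b j)) → T (e · b)
    go zero    b e Tb = T0
    go (suc n) b e Tb = T+ _ _ (multiples-closed T0 T+ (Tb fzero) (e fzero)) (go n (b ∘ fsuc) (e ∘ fsuc) (Tb ∘ fsuc))

Irredundant : (n : ℕ) → (Fin n → ℕ) → Set
Irredundant n b = ∀ i → ¬ (Σ (Fin n → ℕ) λ e → (e i ≡ 0) × (e · b ≡ b i))

Irreducible : Pred → ℕ → Set
Irreducible T z = ∀ x y → T x → T y → 0 < x → 0 < y → z ≢ x + y

module _ {n : ℕ} {b : Fin n → ℕ} (irr : Irredundant n b) where

  irredundant⇒positive : ∀ j → 0 < b j
  irredundant⇒positive j with b j ≟ 0
  ... | yes bj≡0 = ⊥-elim (irr j ((λ _ → 0) , refl , trans (∑-zero n) (sym bj≡0)))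
  ... | no  bj≢0 = n≢0⇒n>0 bj≢0

  irredundant⇒injective : ∀ {i j} → b i ≡ b j → i ≡ j
  irredundant⇒injective {i} {j} bi≡bj with i FP.≟ j
  ... | yes i≡j = i≡j
  ... | no  i≢j = ⊥-elim (irr j (δ i , δ-≢ i≢j , trans (δ·b i b) bi≡bj))

  irredundant⇒irreducible : ∀ l → Irreducible (InMonoid n b) (b l)
  irredundant⇒irreducible l x y (u , refl) (v , refl) x>0 y>0 bl≡x+y =
    irr l ((λ j → u j + v j) , cong₂ _+_ ul≡0 vl≡0 , trans (·-distribʳ-+ u v b) (sym bl≡x+y))
    where
    ul≡0 : u l ≡ 0
    ul≡0 = unused-generator u b l (subst (u · b <_) (sym bl≡x+y) (m<m+n (u · b) y>0))
    vl≡0 : v l ≡ 0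
    vl≡0 = unused-generator v b l (subst (v · b <_) (sym bl≡x+y) (m<n+m (v · b) x>0))

irreducible⇒least-in-class : ∀ {n} {b : Fin n → ℕ} {z d} .{{_ : NonZero d}} →
  InMonoid n b d → Irreducible (InMonoid n b) z →
  ∀ y → InMonoid n b y → 0 < y → y % d ≡ z % d → z ≤ y
irreducible⇒least-in-class {z = z} {d} d∈ z-irr y y∈ y>0 y%d≡z%d with z ≤? y
... | yes z≤y = z≤y
... | no  z≰y with %-≡⇒≡+* d y%d≡z%d (<⇒≤ (≰⇒> z≰y))
...   | zero  , z≡y+0 = ⊥-elim (z≰y (≤-reflexive (trans z≡y+0 (+-identityʳ y))))
...   | suc s , z≡y+sd = ⊥-elim (z-irr y (suc s * d) y∈ (InMonoid-* d∈ (suc s)) y>0 sd>0 z≡y+sd)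
  where
  sd>0 : 0 < suc s * d
  sd>0 = <-≤-trans (>-nonZero⁻¹ d) (m≤m+n d (s * d))

irredundant⇒residue-injective : ∀ {n} {b : Fin n → ℕ} {d} .{{_ : NonZero d}} →
  Irredundant n b → InMonoid n b d → ∀ {i j} → b i % d ≡ b j % d → i ≡ j
irredundant⇒residue-injective {b = b} irr d∈ {i} {j} bi≡bj = irredundant⇒injective irr (≤-antisym
  (irreducible⇒least-in-class d∈ (irredundant⇒irreducible irr i) (b j) (InMonoid-gen j) (irredundant⇒positive irr j) (sym bi≡bj))
  (irreducible⇒least-in-class d∈ (irredundant⇒irreducible irr j) (b i) (InMonoid-gen i) (irredundant⇒positive irr i) bi≡bj))

MEDClosed : ℕ → Pred → Set
MEDClosed m T = ∀ x y z → T x → T y → 0 < x → 0 < y → x + y ≡ z + m → T z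

-- With exactly d generators the residues mod d of the generators exhaust Fin d, so x + y lies
-- above some generator b l of its class; x + y ≠ b l by irreducibility, hence x + y ∸ d ∈ ⟨b⟩.
irredundant⇒MEDClosed : ∀ {d} {b : Fin d → ℕ} .{{_ : NonZero d}} →
  Irredundant d b → InMonoid d b d → MEDClosed d (InMonoid d b)
irredundant⇒MEDClosed {d} {b} irr d∈ x y z x∈ y∈ x>0 y>0 x+y≡z+d
  with injective⇒surjective (λ j → b j mod d)
         (irredundant⇒residue-injective irr d∈ ∘ mod-≡⇒%-≡ d) ((x + y) mod d)
... | l , bl≡x+y
  with %-≡⇒≡+* d (mod-≡⇒%-≡ d bl≡x+y)
         (irreducible⇒least-in-class d∈ (irredundant⇒irreducible irr l) (x + y)
            (InMonoid-+ x y x∈ y∈) (<-≤-trans x>0 (m≤m+n x y)) (sym (mod-≡⇒%-≡ d bl≡x+y)))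
...   | zero  , x+y≡bl+0 =
  ⊥-elim (irredundant⇒irreducible irr l x y x∈ y∈ x>0 y>0 (sym (trans x+y≡bl+0 (+-identityʳ (b l)))))
...   | suc s , x+y≡bl+sd = subst (InMonoid d b) z≡ (InMonoid-+ _ _ (InMonoid-gen l) (InMonoid-* d∈ s))
  where
  z≡ : b l + s * d ≡ z
  z≡ = +-cancelʳ-≡ d (b l + s * d) z (begin
    b l + s * d + d   ≡⟨ +-assoc (b l) (s * d) d ⟩
    b l + (s * d + d) ≡⟨ cong (b l +_) (+-comm (s * d) d) ⟩
    b l + suc s * d   ≡⟨ sym x+y≡bl+sd ⟩
    x + y             ≡⟨ x+y≡z+d ⟩
    z + d             ∎)
    where open ≡-Reasoning

multiplicity-unique : ∀ {T m m'} → IsMultiplicity T m → IsMultiplicity T m' → m ≡ m'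
multiplicity-unique (m>0 , m∈ , m-least) (m'>0 , m'∈ , m'-least) =
  ≤-antisym (m-least _ m'∈ m'>0) (m'-least _ m∈ m>0)

MED⇒MEDClosed : ∀ {T m} → IsMultiplicity T m → IsMED T → MEDClosed m T
MED⇒MEDClosed mult (e , mult-e@(e>0 , e∈T , _) , b , T⊆ , ⊆T , irr) with multiplicity-unique mult mult-e
... | refl = λ x y z x∈ y∈ x>0 y>0 x+y≡z+e → ⊆T z
  (irredundant⇒MEDClosed {{>-nonZero e>0}} irr (T⊆ _ e∈T) x y z (T⊆ x x∈) (T⊆ y y∈) x>0 y>0 x+y≡z+e)

least-in-class⇒irreducible : ∀ {T : Pred} {m z} .{{_ : NonZero m}} → MEDClosed m T →
  (∀ y → T y → 0 < y → m ≤ y) → (∀ y → T y → 0 < y → y % m ≡ z % m → z ≤ y) → Irreducible T z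
least-in-class⇒irreducible {T} {m} {z} T-closed m-least z-least x y x∈ y∈ x>0 y>0 z≡x+y =
  <⇒≱ (m<m+n w (>-nonZero⁻¹ m)) (subst (_≤ w) z≡w+m (z-least w w∈ w>0 w%m≡z%m))
  where
  w = x + (y ∸ m)
  z≡w+m : z ≡ w + m
  z≡w+m = trans z≡x+y (trans (cong (x +_) (sym (m∸n+n≡m (m-least y y∈ y>0)))) (sym (+-assoc x (y ∸ m) m)))
  w∈ : T w
  w∈ = T-closed x y w x∈ y∈ x>0 y>0 (trans (sym z≡x+y) z≡w+m)
  w>0 : 0 < w
  w>0 = <-≤-trans x>0 (m≤m+n x (y ∸ m))
  w%m≡z%m : w % m ≡ z % m
  w%m≡z%m = trans (sym ([m+n]%n≡m%n w m)) (%-congˡ (sym z≡w+m))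

irreducible⇒irredundant : ∀ {n} {b : Fin n → ℕ} → (∀ j → 0 < b j) → (∀ {i j} → b i ≡ b j → i ≡ j) →
  (∀ j → Irreducible (InMonoid n b) (b j)) → Irredundant n b
irreducible⇒irredundant {b = b} b>0 b-inj b-irr i (e , ei≡0 , e·b≡bi)
  with extract-generator e b (subst (0 <_) (sym e·b≡bi) (b>0 i))
... | p , ep>0 , e·b≡u+bp with (λ j → e j ∸ δ p j) · b ≟ 0
...   | yes u≡0 = <⇒≢ ep>0 (sym (trans (cong e (b-inj bi≡bp)) ei≡0))
  where
  bi≡bp : b p ≡ b i
  bi≡bp = trans (sym (trans e·b≡u+bp (cong (_+ b p) u≡0))) e·b≡bi
...   | no  u≢0 = b-irr i _ _ ((λ j → e j ∸ δ p j) , refl) (InMonoid-gen p) (n≢0⇒n>0 u≢0) (b>0 p)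
  (trans (sym e·b≡bi) e·b≡u+bp)

-- Factorizations and the shifted monoid m + ⟨m, w⟩

module _ {A : Set} (f : A → ℕ) where

  sum-map-++ : ∀ L₁ L₂ → sum (map f (L₁ ++ L₂)) ≡ sum (map f L₁) + sum (map f L₂)
  sum-map-++ L₁ L₂ = trans (cong sum (map-++ f L₁ L₂)) (sum-++ (map f L₁) (map f L₂))

  sum-map-≤ : ∀ c → (∀ x → f x ≤ c) → ∀ L → sum (map f L) ≤ length L * c
  sum-map-≤ c f≤c []      = z≤n
  sum-map-≤ c f≤c (x ∷ L) = +-mono-≤ (f≤c x) (sum-map-≤ c f≤c L)

  sum-map-+const : ∀ (g : A → ℕ) c → (∀ x → f x ≡ g x + c) → ∀ L → sum (map f L) ≡ sum (map g L) + length L * c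
  sum-map-+const g c f≡g+c []      = refl
  sum-map-+const g c f≡g+c (x ∷ L) = begin
    f x + sum (map f L)                          ≡⟨ cong₂ _+_ (f≡g+c x) (sum-map-+const g c f≡g+c L) ⟩
    g x + c + (sum (map g L) + length L * c)     ≡⟨ regroup (g x) c (sum (map g L)) (length L * c) ⟩
    g x + sum (map g L) + (c + length L * c)     ∎
    where
    open ≡-Reasoning
    regroup : ∀ a b c d → a + b + (c + d) ≡ a + c + (b + d)
    regroup = solve-∀

prefix-sum-split : ∀ {u v} (xs : List ℕ) → u ≤ v → sum (take v xs) ≡ sum (take u xs) + sum (drop u (take v xs))
prefix-sum-split {u} {v} xs u≤v = begin
  sum (take v xs)                                       ≡⟨ cong sum (take++drop≡id u (take v xs)) ⟨
  sum (take u (take v xs) ++ drop u (take v xs))        ≡⟨ sum-++ (take u (take v xs)) _ ⟩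
  sum (take u (take v xs)) + sum (drop u (take v xs))   ≡⟨ cong (λ ys → sum ys + sum (drop u (take v xs))) take-u-take-v ⟩
  sum (take u xs) + sum (drop u (take v xs))            ∎
  where
  open ≡-Reasoning
  take-u-take-v : take u (take v xs) ≡ take u xs
  take-u-take-v = trans (take-take u v xs) (cong (λ k → take k xs) (m≤n⇒m⊓n≡m u≤v))

-- Pigeonhole on the m + 1 prefix sums of lengths 0, 1, …, m: two of them agree mod m, and the
-- block between them has weight Q * m.
zero-sum-shortening : ∀ {A : Set} m .{{_ : NonZero m}} (f : A → ℕ) (L : List A) → m ≤ length L →
  Σ (List A) λ L' → Σ ℕ λ Q → length L' < length L × sum (map f L) ≡ Q * m + sum (map f L')
zero-sum-shortening m f L m≤|L| with FP.pigeonhole (n<1+n m) (λ i → sum (take (toℕ i) (map f L)) mod m)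
... | i , j , i<j , same-residue
  with %-≡⇒≡+* m (mod-≡⇒%-≡ m same-residue)
         (≤-trans (m≤m+n _ _) (≤-reflexive (sym (prefix-sum-split (map f L) (<⇒≤ i<j)))))
...   | Q , prefix-j≡prefix-i+Qm = take u L ++ drop v L , Q , shorter , sum≡
  where
  u = toℕ i
  v = toℕ j
  xs = map f L
  v≤|L| : v ≤ length L
  v≤|L| = ≤-trans (s≤s⁻¹ (FP.toℕ<n j)) m≤|L|
  shorter : length (take u L ++ drop v L) < length L
  shorter = begin-strict
    length (take u L ++ drop v L)   ≡⟨ length-++ (take u L) ⟩
    length (take u L) + length (drop v L) ≡⟨ cong₂ _+_ (trans (length-take u L) (m≤n⇒m⊓n≡m (≤-trans (<⇒≤ i<j) v≤|L|))) (length-drop v L) ⟩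
    u + (length L ∸ v)              <⟨ +-monoˡ-< (length L ∸ v) i<j ⟩
    v + (length L ∸ v)              ≡⟨ m+[n∸m]≡n v≤|L| ⟩
    length L                        ∎
    where open ≤-Reasoning
  sum≡ : sum xs ≡ Q * m + sum (map f (take u L ++ drop v L))
  sum≡ = begin
    sum xs                                          ≡⟨ cong sum (take++drop≡id v xs) ⟨
    sum (take v xs ++ drop v xs)                    ≡⟨ sum-++ (take v xs) (drop v xs) ⟩
    sum (take v xs) + sum (drop v xs)               ≡⟨ cong (_+ sum (drop v xs)) prefix-j≡prefix-i+Qm ⟩
    sum (take u xs) + Q * m + sum (drop v xs)       ≡⟨ regroup (sum (take u xs)) (Q * m) (sum (drop v xs)) ⟩
    Q * m + (sum (take u xs) + sum (drop v xs))     ≡⟨ cong₂ (λ ys zs → Q * m + (sum ys + sum zs)) (take-map u L) (drop-map v L) ⟩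
    Q * m + (sum (map f (take u L)) + sum (map f (drop v L))) ≡⟨ cong (Q * m +_) (sum-map-++ f (take u L) (drop v L)) ⟨
    Q * m + sum (map f (take u L ++ drop v L))      ∎
    where
    open ≡-Reasoning
    regroup : ∀ a b c → a + b + c ≡ b + (a + c)
    regroup = solve-∀

HasFactorization : (n : ℕ) → (Fin n → ℕ) → ℕ → ℕ → Set
HasFactorization n b x ℓ = Σ (Fin n → ℕ) λ e → (e · b ≡ x) × (∑ n e ≡ ℓ)

module _ {n : ℕ} {b : Fin n → ℕ} where

  factorization-0 : HasFactorization n b 0 0
  factorization-0 = (λ _ → 0) , ∑-zero n , ∑-zero n

  factorization-+ : ∀ {x y ℓ ℓ'} → HasFactorization n b x ℓ → HasFactorization n b y ℓ' →
    HasFactorization n b (x + y) (ℓ + ℓ')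
  factorization-+ (u , u·b≡x , ∑u≡ℓ) (v , v·b≡y , ∑v≡ℓ') = (λ j → u j + v j) ,
    trans (·-distribʳ-+ u v b) (cong₂ _+_ u·b≡x v·b≡y) , trans (∑-distrib-+ n u v) (cong₂ _+_ ∑u≡ℓ ∑v≡ℓ')

  factorization-gen : ∀ j → HasFactorization n b (b j) 1
  factorization-gen j = δ j , δ·b j b , trans (∑-cong n (λ i → sym (*-identityʳ (δ j i)))) (δ·b j (λ _ → 1))

  factorization-* : ∀ j p → HasFactorization n b (p * b j) p
  factorization-* j zero    = factorization-0
  factorization-* j (suc p) = factorization-+ (factorization-gen j) (factorization-* j p)

  factorization-list : ∀ L → HasFactorization n b (sum (map b L)) (length L)
  factorization-list []      = factorization-0
  factorization-list (j ∷ L) = factorization-+ (factorization-gen j) (factorization-list L)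

max-length-≥ : ∀ {n a c K ℓ} → IsMaxLength n a c K → HasFactorization n a c ℓ → ℓ ≤ K
max-length-≥ {K = K} (_ , K-max) (e , e·a≡c , ∑e≡ℓ) = subst (_≤ K) ∑e≡ℓ (K-max e e·a≡c)

-- The set m + ⟨m, w₀, …, wₙ₋₁⟩: an element m + t * m + wᵢ₁ + ⋯ + wᵢₗ is given by t and the
-- list of indices [i₁, …, iₗ].
module ShiftedMonoid (m : ℕ) .{{_ : NonZero m}} {n : ℕ} (w : Fin n → ℕ) where

  Shifted : Pred
  Shifted y = Σ (List (Fin n)) λ L → Σ ℕ λ t → y ≡ suc t * m + sum (map w L)

  Shifted-≥ : ∀ {y} → Shifted y → m ≤ y
  Shifted-≥ (L , t , refl) = ≤-trans (m≤m+n m (t * m)) (m≤m+n _ _)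

  Shifted-m : Shifted m
  Shifted-m = [] , 0 , sym (trans (+-identityʳ _) (+-identityʳ m))

  Shifted-m+w : ∀ j → Shifted (m + w j)
  Shifted-m+w j = j ∷ [] , 0 , cong₂ _+_ (sym (+-identityʳ m)) (sym (+-identityʳ (w j)))

  Shifted-+ : Closed+ Shifted
  Shifted-+ _ _ (L₁ , t₁ , refl) (L₂ , t₂ , refl) = L₁ ++ L₂ , t₁ + suc t₂ ,
    trans (regroup t₁ t₂ m (sum (map w L₁)) (sum (map w L₂))) (cong (suc (t₁ + suc t₂) * m +_) (sym (sum-map-++ w L₁ L₂)))
    where
    regroup : ∀ t₁ t₂ m s₁ s₂ → (1 + t₁) * m + s₁ + ((1 + t₂) * m + s₂) ≡ (1 + (t₁ + (1 + t₂))) * m + (s₁ + s₂)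
    regroup = solve-∀

  Shifted-MEDClosed : MEDClosed m Shifted
  Shifted-MEDClosed _ _ z (L₁ , t₁ , refl) (L₂ , t₂ , refl) _ _ x+y≡z+m = L₁ ++ L₂ , t₁ + t₂ ,
    +-cancelʳ-≡ m z _ (trans (sym x+y≡z+m)
      (trans (regroup t₁ t₂ m (sum (map w L₁)) (sum (map w L₂))) (cong (λ s → suc (t₁ + t₂) * m + s + m) (sym (sum-map-++ w L₁ L₂)))))
    where
    regroup : ∀ t₁ t₂ m s₁ s₂ → (1 + t₁) * m + s₁ + ((1 + t₂) * m + s₂) ≡ (1 + (t₁ + t₂)) * m + (s₁ + s₂) + m
    regroup = solve-∀

  m+⟨w⟩⊆Shifted : ∀ x → InMonoid n w x → Shifted (m + x)
  m+⟨w⟩⊆Shifted = InMonoid-⊆ (λ x → Shifted (m + x)) (subst Shifted (sym (+-identityʳ m)) Shifted-m)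
    (λ x y m+x∈ m+y∈ → Shifted-MEDClosed _ _ _ m+x∈ m+y∈ (m+x>0 x) (m+x>0 y) (regroup m x y))
    Shifted-m+w
    where
    m+x>0 : ∀ x → 0 < m + x
    m+x>0 x = <-≤-trans (>-nonZero⁻¹ m) (m≤m+n m x)
    regroup : ∀ m x y → m + x + (m + y) ≡ m + (x + y) + m
    regroup = solve-∀

  Shifted-⊆ : ∀ {T : Pred} → T 0 → Closed+ T → MEDClosed m T → T m → (∀ j → T (m + w j)) → Shifted ⊆ T
  Shifted-⊆ {T} T-0 T-+ T-closed T-m T-m+w _ (L , t , refl) = go L t
    where
    go : ∀ L t → T (suc t * m + sum (map w L))
    go []      t = subst T (sym (+-identityʳ _)) (multiples-closed T-0 T-+ T-m (suc t))
    go (j ∷ L) t = T-closed _ _ _ (go L t) (T-m+w j)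
      (<-≤-trans (>-nonZero⁻¹ m) (Shifted-≥ (L , t , refl))) (<-≤-trans (>-nonZero⁻¹ m) (m≤m+n m (w j)))
      (regroup (suc t * m) (sum (map w L)) m (w j))
      where
      regroup : ∀ a s m x → a + s + (m + x) ≡ a + (x + s) + m
      regroup = solve-∀

  Shifted-short : ∀ {y} → Shifted y → Σ (List (Fin n)) λ L → Σ ℕ λ t → length L < m × y ≡ suc t * m + sum (map w L)
  Shifted-short (L , t , y≡) = go L t y≡ (<-wellFounded (length L))
    where
    go : ∀ {y} L t → y ≡ suc t * m + sum (map w L) → Acc _<_ (length L) →
      Σ (List (Fin n)) λ L → Σ ℕ λ t → length L < m × y ≡ suc t * m + sum (map w L)
    go L t y≡ (acc shorter) with m ≤? length L
    ... | no  m≰|L| = L , t , ≰⇒> m≰|L| , y≡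
    ... | yes m≤|L| with zero-sum-shortening m w L m≤|L|
    ...   | L' , Q , |L'|<|L| , sum≡ = go L' (t + Q) (trans y≡ (trans (cong (suc t * m +_) sum≡)
                                          (regroup t Q m (sum (map w L'))))) (shorter |L'|<|L|)
      where
      regroup : ∀ t Q m s → (1 + t) * m + (Q * m + s) ≡ (1 + (t + Q)) * m + s
      regroup = solve-∀

-- The MED closure of S

m∸1≤2*[m/n]*[n∸1] : ∀ m N → 1 ≤ N → suc N ≤ m → m ∸ 1 ≤ 2 * (m / suc N) * N
m∸1≤2*[m/n]*[n∸1] m N 1≤N n≤m = subst (m ∸ 1 ≤_) (m+n∸n≡m (2 * q * N) 1) (∸-monoˡ-≤ 1 (begin
  m                    ≡⟨ m≡m%n+[m/n]*n m (suc N) ⟩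
  m % suc N + q * suc N ≤⟨ bound (m % suc N) q N (s≤s⁻¹ (m%n<n m (suc N))) (m≥n⇒m/n>0 n≤m) 1≤N ⟩
  2 * q * N + 1        ∎))
  where
  open ≤-Reasoning
  q = m / suc N
  bound : ∀ r q N → r ≤ N → 1 ≤ q → 1 ≤ N → r + q * suc N ≤ 2 * q * N + 1
  bound r (suc q) (suc N) r≤N _ _ = begin
    r + suc q * suc (suc N)               ≤⟨ +-monoˡ-≤ _ r≤N ⟩
    suc N + suc q * suc (suc N)           ≤⟨ m≤m+n _ (q * N) ⟩
    suc N + suc q * suc (suc N) + q * N   ≡⟨ expand q N ⟩
    2 * suc q * suc N + 1                 ∎
    where
    expand : ∀ q N → (1 + N) + (1 + q) * (2 + N) + q * N ≡ 2 * (1 + q) * (1 + N) + 1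
    expand = solve-∀

-- The last hypothesis is c ≥ d(S) * Σ with the denominator of d(S) cleared, where b = a₂ ∸ m,
-- Σ = a₂ + ⋯ + aₙ, A = aₙ, N = n ∸ 1 and q = ⌊m / n⌋.
[m∸1]*A≤c : ∀ {m N A b Σ q c} → 0 < m → 0 < b → Σ ≤ N * A → N * (m + b) ≤ Σ → N ≤ m → m ∸ 1 ≤ 2 * q * N →
  (2 * A * q + 1) * Σ ≤ c * b + m * Σ → (m ∸ 1) * A ≤ c
[m∸1]*A≤c {suc M} {N} {A} {b@(suc _)} {Σ} {q} {c} _ _ Σ≤NA N[m+b]≤Σ N≤m M≤2qN c-large =
  *-cancelʳ-≤ (M * A) c b (+-cancelʳ-≤ (suc M * Σ) (M * A * b) (c * b) (begin
    M * A * b + suc M * Σ                ≡⟨ split (M * A * b) M Σ ⟩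
    M * A * b + M * Σ + Σ                ≤⟨ +-monoˡ-≤ Σ key ⟩
    2 * A * q * Σ + Σ                    ≡⟨ collect (2 * A * q) Σ ⟩
    (2 * A * q + 1) * Σ                  ≤⟨ c-large ⟩
    c * b + suc M * Σ                    ∎))
  where
  open ≤-Reasoning
  key : M * A * b + M * Σ ≤ 2 * A * q * Σ
  key = begin
    M * A * b + M * Σ              ≤⟨ +-monoʳ-≤ (M * A * b) (*-monoʳ-≤ M Σ≤NA) ⟩
    M * A * b + M * (N * A)        ≡⟨ factor M A b N ⟩
    A * M * (b + N)                ≤⟨ *-monoʳ-≤ (A * M) (+-monoʳ-≤ b N≤m) ⟩
    A * M * (b + suc M)            ≤⟨ *-monoˡ-≤ (b + suc M) (*-monoʳ-≤ A M≤2qN) ⟩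
    A * (2 * q * N) * (b + suc M)  ≡⟨ reassociate A q N b (suc M) ⟩
    2 * A * q * (N * (suc M + b))  ≤⟨ *-monoʳ-≤ (2 * A * q) N[m+b]≤Σ ⟩
    2 * A * q * Σ                  ∎
    where
    factor : ∀ M A b N → M * A * b + M * (N * A) ≡ A * M * (b + N)
    factor = solve-∀
    reassociate : ∀ A q N b m → A * (2 * q * N) * (b + m) ≡ 2 * A * q * (N * (m + b))
    reassociate = solve-∀
  split : ∀ X M Σ → X + (1 + M) * Σ ≡ X + M * Σ + Σ
  split = solve-∀
  collect : ∀ Y Σ → Y * Σ + Σ ≡ (Y + 1) * Σ
  collect = solve-∀

module MEDClosureConstruction (k : ℕ) (S : Pred) (a : Fin (2 + k) → ℕ)
  (S-ns : IsNumSemigroup S) (S-gen : IsMinimalGenerators S (2 + k) a) (a-inc : StrictlyIncreasing (2 + k) a)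
  (c K : ℕ → ℕ)
  (c-large : ∀ i → 1 ≤ i → i < a fzero →
    c i * (a (fsuc fzero) ∸ a fzero) + a fzero * ∑ (suc k) (λ j → a (fsuc j))
      ≥ (2 * a (fromℕ (suc k)) * (a fzero / (2 + k)) + 1) * ∑ (suc k) (λ j → a (fsuc j)))
  (c-residue : ∀ i → 1 ≤ i → i < a fzero → ∃ λ q → c i ≡ q * a fzero + i)
  (c-max-length : ∀ i → 1 ≤ i → i < a fzero → IsMaxLength (2 + k) a (c i) (K i))
  where

  m : ℕ
  m = a fzero

  a-irr : Irredundant (2 + k) a
  a-irr = proj₂ (proj₂ S-gen)

  a∈S : ∀ j → S (a j)
  a∈S j = proj₁ (proj₂ S-gen) (a j) (InMonoid-gen {b = a} j)

  m>0 : 0 < m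
  m>0 = irredundant⇒positive a-irr fzero

  instance
    m-nonZero : NonZero m
    m-nonZero = >-nonZero m>0

  a≥m : ∀ j → m ≤ a j
  a≥m fzero    = ≤-refl
  a≥m (fsuc j) = <⇒≤ (a-inc fzero (fsuc j) (s≤s z≤n))

  n≤m : 2 + k ≤ m
  n≤m = FP.injective⇒≤ {f = λ j → a j mod m} (irredundant⇒residue-injective a-irr (InMonoid-gen {b = a} fzero) ∘ mod-≡⇒%-≡ m)

  A : ℕ
  A = a (fromℕ (suc k))

  a≤A : ∀ j → a j ≤ A
  a≤A j with j FP.≟ fromℕ (suc k)
  ... | yes refl     = ≤-refl
  ... | no  j≢last = <⇒≤ (a-inc j (fromℕ (suc k)) (FP.≤∧≢⇒< (FP.≤fromℕ j) j≢last))

  a₂≤a : ∀ j → a (fsuc fzero) ≤ a (fsuc j)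
  a₂≤a fzero    = ≤-refl
  a₂≤a (fsuc j) = <⇒≤ (a-inc (fsuc fzero) (fsuc (fsuc j)) (s≤s (s≤s z≤n)))

  c≥[m∸1]*A : ∀ {i} → 1 ≤ i → i < m → (m ∸ 1) * A ≤ c i
  c≥[m∸1]*A {i} 1≤i i<m = [m∸1]*A≤c m>0 (m<n⇒0<n∸m (a-inc fzero (fsuc fzero) (s≤s z≤n)))
    (∑-≤-const (suc k) (a ∘ fsuc) A (a≤A ∘ fsuc))
    (subst (λ a₂ → suc k * a₂ ≤ ∑ (suc k) (a ∘ fsuc)) (sym (m+[n∸m]≡n (a≥m (fsuc fzero))))
      (∑-≥-const (suc k) (a ∘ fsuc) (a (fsuc fzero)) a₂≤a))
    (≤-trans (n≤1+n (suc k)) n≤m)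
    (m∸1≤2*[m/n]*[n∸1] m (suc k) (s≤s z≤n) n≤m)
    (c-large i 1≤i i<m)

  c%m≡i : ∀ {i} → 1 ≤ i → i < m → c i % m ≡ i
  c%m≡i {i} 1≤i i<m with c-residue i 1≤i i<m
  ... | q , c≡qm+i = trans (%-congˡ (trans c≡qm+i (+-comm (q * m) i)))
                           (trans ([m+kn]%n≡m%n i q m) (m<n⇒m%n≡m i<m))

  w : Fin (2 + k) → ℕ
  w j = a j ∸ m

  a≡w+m : ∀ j → a j ≡ w j + m
  a≡w+m j = sym (m∸n+n≡m (a≥m j))

  m+w≡a : ∀ j → m + w j ≡ a j
  m+w≡a j = trans (+-comm m (w j)) (sym (a≡w+m j))

  open ShiftedMonoid m w

  g : ℕ → ℕ
  g = gSeq m c K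

  g-decomposition : ∀ {i} → 1 ≤ i → i < m → ∃ λ x → InMonoid (2 + k) w x × g i ≡ m + x × c i ≡ x + K i * m
  g-decomposition {suc i} 1≤i i<m with proj₁ (c-max-length (suc i) 1≤i i<m)
  ... | e , e·a≡c , ∑e≡K = e · w , (e , refl) , g≡m+e·w , c≡e·w+Km
    where
    open ≡-Reasoning
    c≡e·w+Km : c (suc i) ≡ e · w + K (suc i) * m
    c≡e·w+Km = begin
      c (suc i)                   ≡⟨ e·a≡c ⟨
      e · a                       ≡⟨ ∑-cong (2 + k) (λ j → cong (e j *_) (a≡w+m j)) ⟩
      e · (λ j → w j + m)         ≡⟨ ·-distribˡ-+ e w (λ _ → m) ⟩
      e · w + e · (λ _ → m)       ≡⟨ cong (e · w +_) (trans (∑-distribʳ-* (2 + k) e m) (cong (_* m) ∑e≡K)) ⟩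
      e · w + K (suc i) * m       ∎
    K≢0 : K (suc i) ≢ 0
    K≢0 K≡0 = 0≢1+n (trans (sym (trans (%-congˡ c≡0) (m*n%n≡0 0 m))) (c%m≡i 1≤i i<m))
      where
      c≡0 : c (suc i) ≡ 0
      c≡0 = trans c≡e·w+Km (cong₂ (λ x K → x + K * m) (∑≡0⇒·≡0 (2 + k) e w (trans ∑e≡K K≡0)) K≡0)
    K′ = K (suc i) ∸ 1
    K≡1+K′ : K (suc i) ≡ 1 + K′
    K≡1+K′ = sym (m+[n∸m]≡n (n≢0⇒n>0 K≢0))
    g≡m+e·w : g (suc i) ≡ m + e · w
    g≡m+e·w = begin
      c (suc i) ∸ K′ * m              ≡⟨ cong (_∸ K′ * m) c≡e·w+Km ⟩
      e · w + K (suc i) * m ∸ K′ * m  ≡⟨ cong (λ κ → e · w + κ * m ∸ K′ * m) K≡1+K′ ⟩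
      e · w + (m + K′ * m) ∸ K′ * m   ≡⟨ cong (_∸ K′ * m) (+-assoc (e · w) m (K′ * m)) ⟨
      e · w + m + K′ * m ∸ K′ * m     ≡⟨ m+n∸n≡m (e · w + m) (K′ * m) ⟩
      e · w + m                       ≡⟨ +-comm (e · w) m ⟩
      m + e · w                       ∎

  g+Km≡c+m : ∀ {i} → 1 ≤ i → i < m → g i + K i * m ≡ c i + m
  g+Km≡c+m {i} 1≤i i<m with g-decomposition 1≤i i<m
  ... | x , _ , g≡m+x , c≡x+Km = trans (cong (_+ K i * m) g≡m+x)
    (trans (regroup m x (K i * m)) (cong (_+ m) (sym c≡x+Km)))
    where
    regroup : ∀ m x y → m + x + y ≡ x + y + m
    regroup = solve-∀

  g%m≡i : ∀ {i} → i < m → g i % m ≡ i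
  g%m≡i {zero}  _   = n%n≡0 m
  g%m≡i {suc i} i<m = begin
    g (suc i) % m                   ≡⟨ [m+kn]%n≡m%n (g (suc i)) (K (suc i)) m ⟨
    (g (suc i) + K (suc i) * m) % m ≡⟨ %-congˡ (g+Km≡c+m (s≤s z≤n) i<m) ⟩
    (c (suc i) + m) % m             ≡⟨ [m+n]%n≡m%n (c (suc i)) m ⟩
    c (suc i) % m                   ≡⟨ c%m≡i (s≤s z≤n) i<m ⟩
    suc i                           ∎
    where open ≡-Reasoning

  g∈Shifted : ∀ {i} → i < m → Shifted (g i)
  g∈Shifted {zero}  _   = Shifted-m
  g∈Shifted {suc i} i<m with g-decomposition (s≤s z≤n) i<m
  ... | x , x∈⟨w⟩ , g≡m+x , _ = subst Shifted (sym g≡m+x) (m+⟨w⟩⊆Shifted x x∈⟨w⟩)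

  Shifted-weight : ∀ {y} L t → y ≡ suc t * m + sum (map w L) → y + length L * m ≡ sum (map a L) + suc t * m
  Shifted-weight {y} L t y≡ = begin
    y + length L * m                          ≡⟨ cong (_+ length L * m) y≡ ⟩
    suc t * m + sum (map w L) + length L * m  ≡⟨ regroup (suc t * m) (sum (map w L)) (length L * m) ⟩
    sum (map w L) + length L * m + suc t * m  ≡⟨ cong (_+ suc t * m) (sum-map-+const a w m a≡w+m L) ⟨
    sum (map a L) + suc t * m                 ∎
    where
    open ≡-Reasoning
    regroup : ∀ t s l → t + s + l ≡ s + l + t
    regroup = solve-∀

  c-above-short : ∀ {i y} L t → 1 ≤ i → i < m → length L < m → y ≡ suc t * m + sum (map w L) → y % m ≡ i →
    ∃ λ p → c i ≡ sum (map a L) + p * m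
  c-above-short {i} {y} L t 1≤i i<m |L|<m y≡ y%m≡i = %-≡⇒≡+* m residues z≤c
    where
    open ≡-Reasoning
    z = sum (map a L)
    z≤c : z ≤ c i
    z≤c = ≤-trans (sum-map-≤ a A a≤A L) (≤-trans (*-monoˡ-≤ A (∸-monoˡ-≤ 1 |L|<m)) (c≥[m∸1]*A 1≤i i<m))
    residues : z % m ≡ c i % m
    residues = begin
      z % m                      ≡⟨ [m+kn]%n≡m%n z (suc t) m ⟨
      (z + suc t * m) % m        ≡⟨ %-congˡ (Shifted-weight L t y≡) ⟨
      (y + length L * m) % m     ≡⟨ [m+kn]%n≡m%n y (length L) m ⟩
      y % m                      ≡⟨ trans y%m≡i (sym (c%m≡i 1≤i i<m)) ⟩
      c i % m                    ∎

  g-least : ∀ {i y} → i < m → Shifted y → y % m ≡ i → g i ≤ y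
  g-least {zero}      _   y∈ _ = Shifted-≥ y∈
  g-least {i@(suc _)} {y} i<m y∈ y%m≡i with Shifted-short y∈
  ... | L , t , |L|<m , y≡ with c-above-short L t (s≤s z≤n) i<m |L|<m y≡ y%m≡i
  ...   | p , c≡z+pm = +-cancelʳ-≤ (K i * m) (g i) y (begin
    g i + K i * m                         ≡⟨ g+Km≡c+m (s≤s z≤n) i<m ⟩
    c i + m                               ≡⟨ cong (_+ m) c≡z+pm ⟩
    z + p * m + m                         ≤⟨ +-monoʳ-≤ (z + p * m) (m≤m+n m (t * m)) ⟩
    z + p * m + suc t * m                 ≡⟨ regroup z (p * m) (suc t * m) ⟩
    z + suc t * m + p * m                 ≡⟨ cong (_+ p * m) (Shifted-weight L t y≡) ⟨
    y + length L * m + p * m              ≡⟨ +-assoc y (length L * m) (p * m) ⟩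
    y + (length L * m + p * m)            ≡⟨ cong (y +_) (*-distribʳ-+ m (length L) p) ⟨
    y + (length L + p) * m                ≤⟨ +-monoʳ-≤ y (*-monoˡ-≤ m |L|+p≤K) ⟩
    y + K i * m                           ∎)
    where
    open ≤-Reasoning
    z = sum (map a L)
    |L|+p≤K : length L + p ≤ K i
    |L|+p≤K = max-length-≥ {a = a} (c-max-length i (s≤s z≤n) i<m)
      (subst (λ x → HasFactorization (2 + k) a x (length L + p)) (sym c≡z+pm)
        (factorization-+ {b = a} (factorization-list L) (factorization-* {b = a} fzero p)))
    regroup : ∀ z x y → z + x + y ≡ z + y + x
    regroup = solve-∀

  G : Fin m → ℕ
  G j = g (toℕ j)

  T : Pred
  T = InMonoid m G

  m∈T : T m
  m∈T = subst T (cong g (FP.toℕ-fromℕ< m>0)) (InMonoid-gen (fromℕ< m>0))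

  above-generator∈T : ∀ {y} j → G j ≤ y → G j % m ≡ y % m → T y
  above-generator∈T j G≤y same-class with %-≡⇒≡+* m same-class G≤y
  ... | s , y≡G+sm = subst T (sym y≡G+sm) (InMonoid-+ _ _ (InMonoid-gen j) (InMonoid-* m∈T s))

  Shifted⊆T : Shifted ⊆ T
  Shifted⊆T y y∈ = above-generator∈T (y mod m)
    (g-least (FP.toℕ<n (y mod m)) y∈ (sym (toℕ-mod y m)))
    (trans (g%m≡i (FP.toℕ<n (y mod m))) (toℕ-mod y m))

  T⊆0∪Shifted : T ⊆ (λ x → x ≡ 0 ⊎ Shifted x)
  T⊆0∪Shifted = InMonoid-⊆ _ (inj₁ refl) 0∪Shifted-closed (λ j → inj₂ (g∈Shifted (FP.toℕ<n j)))
    where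
    0∪Shifted-closed : Closed+ (λ x → x ≡ 0 ⊎ Shifted x)
    0∪Shifted-closed _ _ (inj₁ refl) y∈         = y∈
    0∪Shifted-closed x _ (inj₂ x∈)  (inj₁ refl) = inj₂ (subst Shifted (sym (+-identityʳ x)) x∈)
    0∪Shifted-closed x y (inj₂ x∈)  (inj₂ y∈)   = inj₂ (Shifted-+ x y x∈ y∈)

  T⁺⊆Shifted : ∀ {y} → T y → 0 < y → Shifted y
  T⁺⊆Shifted y∈ y>0 with T⊆0∪Shifted _ y∈
  ... | inj₁ refl = ⊥-elim (<-irrefl refl y>0)
  ... | inj₂ y∈′  = y∈′

  T-multiplicity : IsMultiplicity T m
  T-multiplicity = m>0 , m∈T , λ y y∈ y>0 → Shifted-≥ (T⁺⊆Shifted y∈ y>0)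

  T-MEDClosed : MEDClosed m T
  T-MEDClosed x y z x∈ y∈ x>0 y>0 x+y≡z+m =
    Shifted⊆T z (Shifted-MEDClosed x y z (T⁺⊆Shifted x∈ x>0) (T⁺⊆Shifted y∈ y>0) x>0 y>0 x+y≡z+m)

  T-MED : IsMED T
  T-MED = m , T-multiplicity , G , (λ _ y∈ → y∈) , (λ _ y∈ → y∈) ,
    irreducible⇒irredundant G>0 G-injective G-irreducible
    where
    G>0 : ∀ j → 0 < G j
    G>0 j = <-≤-trans m>0 (Shifted-≥ (g∈Shifted (FP.toℕ<n j)))
    G-injective : ∀ {i j} → G i ≡ G j → i ≡ j
    G-injective {i} {j} Gi≡Gj = FP.toℕ-injective
      (trans (sym (g%m≡i (FP.toℕ<n i))) (trans (%-congˡ Gi≡Gj) (g%m≡i (FP.toℕ<n j))))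
    G-irreducible : ∀ j → Irreducible T (G j)
    G-irreducible j = least-in-class⇒irreducible T-MEDClosed (proj₂ (proj₂ T-multiplicity))
      (λ y y∈ y>0 y%m≡G%m → g-least (FP.toℕ<n j) (T⁺⊆Shifted y∈ y>0) (trans y%m≡G%m (g%m≡i (FP.toℕ<n j))))

  S⊆T : S ⊆ T
  S⊆T x x∈S = InMonoid-⊆ T InMonoid-0 InMonoid-+ (λ j → Shifted⊆T (a j) (subst Shifted (m+w≡a j) (Shifted-m+w j)))
    x (proj₁ S-gen x x∈S)

  T-numerical : IsNumSemigroup T
  T-numerical = record
    { has0     = InMonoid-0
    ; closed   = InMonoid-+
    ; cofinite = proj₁ S-cofinite , λ x F<x → S⊆T x (proj₂ S-cofinite x F<x)
    }
    where S-cofinite = IsNumSemigroup.cofinite S-ns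

  T-least : ∀ T′ → IsNumSemigroup T′ → S ⊆ T′ → IsMultiplicity T′ m → IsMED T′ → T ⊆ T′
  T-least T′ T′-ns S⊆T′ T′-multiplicity T′-MED =
    InMonoid-⊆ T′ has0 closed (λ j → Shifted⊆T′ (G j) (g∈Shifted (FP.toℕ<n j)))
    where
    open IsNumSemigroup T′-ns
    a∈T′ : ∀ j → T′ (m + w j)
    a∈T′ j = subst T′ (sym (m+w≡a j)) (S⊆T′ (a j) (a∈S j))
    Shifted⊆T′ : Shifted ⊆ T′
    Shifted⊆T′ = Shifted-⊆ has0 closed (MED⇒MEDClosed T′-multiplicity T′-MED) (proj₁ (proj₂ T′-multiplicity)) a∈T′

  MED-closure : IsMEDClosure S m T
  MED-closure = T-numerical , S⊆T , T-multiplicity , T-MED , T-least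

mainTheorem7 : (k : ℕ) (S : Pred) (a : Fin (2 + k) → ℕ) →
    IsNumSemigroup S → IsMinimalGenerators S (2 + k) a → StrictlyIncreasing (2 + k) a →
    (c K : ℕ → ℕ) →
    (∀ i → 1 ≤ i → i < a fzero →
      S (c i) ×
      (c i * (a (fsuc fzero) ∸ a fzero) + a fzero * ∑ (suc k) (λ j → a (fsuc j))
        ≥ (2 * a (fromℕ (suc k)) * (a fzero / (2 + k)) + 1) * ∑ (suc k) (λ j → a (fsuc j))) ×
      (∃ λ q → c i ≡ q * a fzero + i) ×
      IsMaxLength (2 + k) a (c i) (K i)) →
    IsMEDClosure S (a fzero) (InMonoid (a fzero) (λ j → gSeq (a fzero) c K (toℕ j)))
mainTheorem7 k S a S-ns S-gen a-inc c K hyp =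
  MEDClosureConstruction.MED-closure k S a S-ns S-gen a-inc c K
    (λ i 1≤i i<m → proj₁ (proj₂ (hyp i 1≤i i<m)))
    (λ i 1≤i i<m → proj₁ (proj₂ (proj₂ (hyp i 1≤i i<m))))
    (λ i 1≤i i<m → proj₂ (proj₂ (proj₂ (hyp i 1≤i i<m))))
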